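{- Let $A,B,C$ be polarized uniform groupoids, $S\in\mathbf{U}_{A\multimap B}$ and $T\in\mathbf{U}_{B\multimap C}$, and suppose that $T\odot S\in\mathbf{U}_{A\multimap C}$ is thin. Then every reindexing problem in the composition pullback of $S$ and $T$ has at most one positive solution.
   Context: All groupoids are small. Prestrategies and bipullbacks. A prestrategy on $A$ is $(S,\partial^S:S\to A)$; one from $A$ to $B$ is a prestrategy on $A\times B$, with $\partial^S=\langle\partial^S_A,\partial^S_B\rangle$. For a cospan $S\xrightarrow{u}B\xleftarrow{v}T$ of groupoids: - a pseudocone with vertex $X$ is $(l',r',\nu:ul'\Rightarrow vr')$; - a morphism of pseudocones is $(\alpha,\beta)$ with $\nu''\circ u\alpha=v\beta\circ\nu$; - $(P,l,r,\mu)$ is a bipullback if for every $X$ the functor $h\mapsto(lh,rh,\mu h)$ from functors $X\to P$ to pseudocones with vertex $X$ is an equivalence; - commuting squares have identity $2$-cell. Uniform structure. $S\perp T$ iff the pullback of $S\to B\leftarrow T$ is a bipullback, and $\mathbf{S}^\perp=\{T\mid\forall S\in\mathbf{S},S\perp T\}$. A uniform groupoid is $(A,\mathbf{U}_A)$ with $\mathbf{U}_A^{\perp\perp}=\mathbf{U}_A$. Polarities. A polarized uniform groupoid is a uniform groupoid $A$ together with two subgroupoids $A_-,A_+$ each containing all objects (negative/positive symmetries). For polarized uniform $A,B$, $A\multimap B$ has: - underlying groupoid $A\times B$; - $\mathbf{U}_{A\multimap B}=\{(S\times U,\partial^S\times\partial^U)\mid S\in\mathbf{U}_A,U\in\mathbf{U}_B^\perp\}^\perp$;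 - $(A\multimap B)_-=A_+\times B_-$ and $(A\multimap B)_+=A_-\times B_+$. A prestrategy $S$ on a polarized groupoid $D$ is thin if every morphism $\varphi:s\to s'$ of $S$ with $\partial^S\varphi\in D_+$ satisfies $s=s'$ and $\varphi=\mathrm{id}_s$. Composition and reindexing. - For $S$ from $A$ to $B$ and $T$ from $B$ to $C$, $T\odot S$ is the pullback of $S\xrightarrow{\partial^S_B}B\xleftarrow{\partial^T_B}T$ (the composition pullback) with display $\langle\partial^S_Al,\partial^T_Cr\rangle$. - A reindexing problem in this pullback is a triple $(s,\theta,t)$ with $s\in S$, $t\in T$ and $\theta\in B(\partial^S_Bs,\partial^T_Bt)$. - A solution is a pair $\varphi\in S(s,s')$, $\psi\in T(t',t)$ with $\partial^S_Bs'=\partial^T_Bt'$ and $\theta=\partial^T_B\psi\circ\partial^S_B\varphi$. - The solution is positive if $\partial^S_A\varphi\in A_-$ and $\partial^T_C\psi\in C_+$, i.e. the pair $(\partial^S_A\varphi,\partial^T_C\psi)$ consists of positive symmetries of $A\multimap C$. -}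

module Defs where

open import Level using (Level) renaming (suc to lsuc; zero to 0ℓ)
open import Data.Product using (Σ; Σ-syntax; _×_; _,_; proj₁; proj₂)
open import Relation.Binary.PropositionalEquality
  using (_≡_; refl; subst)
import Relation.Binary.Reasoning.Setoid as SetoidR
open import Relation.Binary.Bundles using (Setoid)

-- Small groupoids (hom-sets carry a setoid equality _≈_, as usual in
-- constructive category theory; objects are compared with _≡_).

record Groupoid : Set₁ where
  infixr 9 _∘_
  infix  4 _≈_
  field
    Obj    : Set
    Hom    : Obj → Obj → Set
    _≈_    : ∀ {x y} → Hom x y → Hom x y → Set
    ≈-refl  : ∀ {x y} {f : Hom x y} → f ≈ f
    ≈-sym   : ∀ {x y} {f g : Hom x y} → f ≈ g → g ≈ f
    ≈-trans : ∀ {x y} {f g h : Hom x y} → f ≈ g → g ≈ h → f ≈ h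
    id     : ∀ {x} → Hom x x
    _∘_    : ∀ {x y z} → Hom y z → Hom x y → Hom x z
    _⁻¹    : ∀ {x y} → Hom x y → Hom y x
    ∘-resp-≈ : ∀ {x y z} {f f' : Hom y z} {g g' : Hom x y} →
               f ≈ f' → g ≈ g' → f ∘ g ≈ f' ∘ g'
    assoc  : ∀ {w x y z} {f : Hom w x} {g : Hom x y} {h : Hom y z} →
             (h ∘ g) ∘ f ≈ h ∘ (g ∘ f)
    identityˡ : ∀ {x y} {f : Hom x y} → id ∘ f ≈ f
    identityʳ : ∀ {x y} {f : Hom x y} → f ∘ id ≈ f
    inverseˡ  : ∀ {x y} {f : Hom x y} → (f ⁻¹) ∘ f ≈ id
    inverseʳ  : ∀ {x y} {f : Hom x y} → f ∘ (f ⁻¹) ≈ id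

  homSetoid : Obj → Obj → Setoid 0ℓ 0ℓ
  homSetoid x y = record
    { Carrier = Hom x y ; _≈_ = _≈_
    ; isEquivalence = record { refl = ≈-refl ; sym = ≈-sym ; trans = ≈-trans } }

  square-inv : ∀ {x y x' y'} {f : Hom x y} {g : Hom x' y'} {a : Hom y y'} {b : Hom x x'} →
               a ∘ f ≈ g ∘ b → b ∘ (f ⁻¹) ≈ (g ⁻¹) ∘ a
  square-inv {f = f} {g} {a} {b} sq = begin
      b ∘ (f ⁻¹)                    ≈⟨ ≈-sym identityˡ ⟩
      id ∘ (b ∘ (f ⁻¹))             ≈⟨ ∘-resp-≈ (≈-sym inverseˡ) ≈-refl ⟩
      ((g ⁻¹) ∘ g) ∘ (b ∘ (f ⁻¹))   ≈⟨ assoc ⟩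
      (g ⁻¹) ∘ (g ∘ (b ∘ (f ⁻¹)))   ≈⟨ ∘-resp-≈ ≈-refl (≈-sym assoc) ⟩
      (g ⁻¹) ∘ ((g ∘ b) ∘ (f ⁻¹))   ≈⟨ ∘-resp-≈ ≈-refl (∘-resp-≈ (≈-sym sq) ≈-refl) ⟩
      (g ⁻¹) ∘ ((a ∘ f) ∘ (f ⁻¹))   ≈⟨ ∘-resp-≈ ≈-refl assoc ⟩
      (g ⁻¹) ∘ (a ∘ (f ∘ (f ⁻¹)))   ≈⟨ ∘-resp-≈ ≈-refl (∘-resp-≈ ≈-refl inverseʳ) ⟩
      (g ⁻¹) ∘ (a ∘ id)             ≈⟨ ∘-resp-≈ ≈-refl identityʳ ⟩
      (g ⁻¹) ∘ a                    ∎
    where open SetoidR (homSetoid _ _)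

open Groupoid using (Obj; Hom)

record Functor (C D : Groupoid) : Set where
  private
    module C = Groupoid C
    module D = Groupoid D
  field
    F₀ : C.Obj → D.Obj
    F₁ : ∀ {x y} → C.Hom x y → D.Hom (F₀ x) (F₀ y)
    F-resp-≈ : ∀ {x y} {f g : C.Hom x y} → f C.≈ g → F₁ f D.≈ F₁ g
    F-id : ∀ {x} → F₁ (C.id {x}) D.≈ D.id
    F-∘  : ∀ {x y z} {f : C.Hom x y} {g : C.Hom y z} →
           F₁ (g C.∘ f) D.≈ F₁ g D.∘ F₁ f

  F-inv : ∀ {x y} {f : C.Hom x y} → F₁ (f C.⁻¹) D.≈ (F₁ f) D.⁻¹
  F-inv {f = f} = begin
      F₁ (f C.⁻¹)                                ≈⟨ D.≈-sym D.identityʳ ⟩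
      F₁ (f C.⁻¹) D.∘ D.id                        ≈⟨ D.∘-resp-≈ D.≈-refl (D.≈-sym D.inverseʳ) ⟩
      F₁ (f C.⁻¹) D.∘ (F₁ f D.∘ (F₁ f) D.⁻¹)       ≈⟨ D.≈-sym D.assoc ⟩
      (F₁ (f C.⁻¹) D.∘ F₁ f) D.∘ (F₁ f) D.⁻¹       ≈⟨ D.∘-resp-≈ (D.≈-sym F-∘) D.≈-refl ⟩
      F₁ (f C.⁻¹ C.∘ f) D.∘ (F₁ f) D.⁻¹            ≈⟨ D.∘-resp-≈ (F-resp-≈ C.inverseˡ) D.≈-refl ⟩
      F₁ C.id D.∘ (F₁ f) D.⁻¹                      ≈⟨ D.∘-resp-≈ F-id D.≈-refl ⟩
      D.id D.∘ (F₁ f) D.⁻¹                         ≈⟨ D.identityˡ ⟩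
      (F₁ f) D.⁻¹                                 ∎
    where open SetoidR (D.homSetoid _ _)

open Functor public

infixr 9 _∘F_
_∘F_ : ∀ {A B C : Groupoid} → Functor B C → Functor A B → Functor A C
_∘F_ {A} {B} {C} G F = record
  { F₀ = λ x → F₀ G (F₀ F x)
  ; F₁ = λ f → F₁ G (F₁ F f)
  ; F-resp-≈ = λ p → F-resp-≈ G (F-resp-≈ F p)
  ; F-id = C.≈-trans (F-resp-≈ G (F-id F)) (F-id G)
  ; F-∘ = C.≈-trans (F-resp-≈ G (F-∘ F)) (F-∘ G)
  }
  where module C = Groupoid C

-- natural transformations (automatically natural isomorphisms, since the
-- target is a groupoid)
record NatTrans {C D : Groupoid} (F G : Functor C D) : Set where
  private
    module C = Groupoid C
    module D = Groupoid D
  field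
    η : ∀ x → D.Hom (F₀ F x) (F₀ G x)
    natural : ∀ {x y} (f : C.Hom x y) → η y D.∘ F₁ F f D.≈ F₁ G f D.∘ η x

open NatTrans public

module _ {S B T : Groupoid} (u : Functor S B) (v : Functor T B) where
  private
    module S = Groupoid S
    module B = Groupoid B
    module T = Groupoid T

  record Pseudocone (X : Groupoid) : Set where
    field
      l' : Functor X S
      r' : Functor X T
      ν  : NatTrans (u ∘F l') (v ∘F r')

  open Pseudocone public

  record PseudoconeMor {X : Groupoid} (c c' : Pseudocone X) : Set where
    field
      α : NatTrans (l' c) (l' c')
      β : NatTrans (r' c) (r' c')
      commutes : ∀ x → η (ν c') x B.∘ F₁ u (η α x) B.≈ F₁ v (η β x) B.∘ η (ν c) x

  open PseudoconeMor public

  coneOf : ∀ {P X : Groupoid} (l : Functor P S) (r : Functor P T)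
           (μ : NatTrans (u ∘F l) (v ∘F r)) (h : Functor X P) → Pseudocone X
  coneOf l r μ h = record
    { l' = l ∘F h
    ; r' = r ∘F h
    ; ν  = record { η = λ x → η μ (F₀ h x) ; natural = λ f → natural μ (F₁ h f) }
    }

  -- (P, l, r, μ) is a bipullback: for every X the functor
  --   h ↦ (l h, r h, μ h)  :  [X , P] → Pseudocones(X)
  -- is an equivalence of groupoids, i.e. it is full, faithful and
  -- essentially surjective (its action on a natural transformation γ is
  -- (l γ, r γ)).
  record IsBipullback (P : Groupoid) (l : Functor P S) (r : Functor P T)
                      (μ : NatTrans (u ∘F l) (v ∘F r)) : Set₁ where
    private module P = Groupoid P
    field
      full : ∀ {X : Groupoid} (h h' : Functor X P)
             (m : PseudoconeMor (coneOf l r μ h) (coneOf l r μ h')) →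
             Σ[ γ ∈ NatTrans h h' ]
               (∀ x → (F₁ l (η γ x) S.≈ η (α m) x) × (F₁ r (η γ x) T.≈ η (β m) x))
      faithful : ∀ {X : Groupoid} (h h' : Functor X P) (γ γ' : NatTrans h h') →
                 (∀ x → F₁ l (η γ x) S.≈ F₁ l (η γ' x)) →
                 (∀ x → F₁ r (η γ x) T.≈ F₁ r (η γ' x)) →
                 ∀ x → η γ x P.≈ η γ' x
      essSurj : ∀ {X : Groupoid} (c : Pseudocone X) →
                Σ[ h ∈ Functor X P ] PseudoconeMor (coneOf l r μ h) c

  -- Writing  tr e : u s → v t
  -- for the identity of B transported along e, a morphism
  -- (s,t,e) → (s',t',e') is a pair (φ , ψ) with  u φ = v ψ  modulo these
  -- identifications, i.e.  tr e' ∘ u φ ≈ v ψ ∘ tr e.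

  tr : ∀ {b b'} → b ≡ b' → B.Hom b b'
  tr {b} e = subst (B.Hom b) e B.id

  record PbObj : Set where
    constructor pbObj
    field
      pb-s : S.Obj
      pb-t : T.Obj
      pb-e : F₀ u pb-s ≡ F₀ v pb-t

  open PbObj public

  record PbHom (p q : PbObj) : Set where
    constructor pbHom
    field
      pb-φ : S.Hom (pb-s p) (pb-s q)
      pb-ψ : T.Hom (pb-t p) (pb-t q)
      pb-c : tr (pb-e q) B.∘ F₁ u pb-φ B.≈ F₁ v pb-ψ B.∘ tr (pb-e p)

  open PbHom public

  private
    pb-comp : ∀ {p q r} → PbHom q r → PbHom p q → PbHom p r
    pb-comp {p} {q} {r} (pbHom φ' ψ' c') (pbHom φ ψ c) = pbHom (φ' S.∘ φ) (ψ' T.∘ ψ) (begin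
        tr (pb-e r) B.∘ F₁ u (φ' S.∘ φ)               ≈⟨ B.∘-resp-≈ B.≈-refl (F-∘ u) ⟩
        tr (pb-e r) B.∘ (F₁ u φ' B.∘ F₁ u φ)          ≈⟨ B.≈-sym B.assoc ⟩
        (tr (pb-e r) B.∘ F₁ u φ') B.∘ F₁ u φ          ≈⟨ B.∘-resp-≈ c' B.≈-refl ⟩
        (F₁ v ψ' B.∘ tr (pb-e q)) B.∘ F₁ u φ          ≈⟨ B.assoc ⟩
        F₁ v ψ' B.∘ (tr (pb-e q) B.∘ F₁ u φ)          ≈⟨ B.∘-resp-≈ B.≈-refl c ⟩
        F₁ v ψ' B.∘ (F₁ v ψ B.∘ tr (pb-e p))          ≈⟨ B.≈-sym B.assoc ⟩
        (F₁ v ψ' B.∘ F₁ v ψ) B.∘ tr (pb-e p)          ≈⟨ B.∘-resp-≈ (B.≈-sym (F-∘ v)) B.≈-refl ⟩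
        F₁ v (ψ' T.∘ ψ) B.∘ tr (pb-e p)               ∎)
      where open SetoidR (B.homSetoid _ _)

    pb-inv : ∀ {p q} → PbHom p q → PbHom q p
    pb-inv {p} {q} (pbHom φ ψ c) = pbHom (φ S.⁻¹) (ψ T.⁻¹) (begin
        tr (pb-e p) B.∘ F₁ u (φ S.⁻¹)       ≈⟨ B.∘-resp-≈ B.≈-refl (F-inv u) ⟩
        tr (pb-e p) B.∘ (F₁ u φ) B.⁻¹       ≈⟨ B.square-inv c ⟩
        (F₁ v ψ) B.⁻¹ B.∘ tr (pb-e q)       ≈⟨ B.∘-resp-≈ (B.≈-sym (F-inv v)) B.≈-refl ⟩
        F₁ v (ψ T.⁻¹) B.∘ tr (pb-e q)       ∎)
      where open SetoidR (B.homSetoid _ _)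

    pb-id : ∀ {p} → PbHom p p
    pb-id {p} = pbHom S.id T.id (begin
        tr (pb-e p) B.∘ F₁ u S.id    ≈⟨ B.∘-resp-≈ B.≈-refl (F-id u) ⟩
        tr (pb-e p) B.∘ B.id         ≈⟨ B.identityʳ ⟩
        tr (pb-e p)                  ≈⟨ B.≈-sym B.identityˡ ⟩
        B.id B.∘ tr (pb-e p)         ≈⟨ B.∘-resp-≈ (B.≈-sym (F-id v)) B.≈-refl ⟩
        F₁ v T.id B.∘ tr (pb-e p)    ∎)
      where open SetoidR (B.homSetoid _ _)

  Pullback : Groupoid
  Pullback = record
    { Obj = PbObj
    ; Hom = PbHom
    ; _≈_ = λ f g → (pb-φ f S.≈ pb-φ g) × (pb-ψ f T.≈ pb-ψ g)
    ; ≈-refl = S.≈-refl , T.≈-refl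
    ; ≈-sym = λ (a , b) → S.≈-sym a , T.≈-sym b
    ; ≈-trans = λ (a , b) (a' , b') → S.≈-trans a a' , T.≈-trans b b'
    ; id = pb-id
    ; _∘_ = pb-comp
    ; _⁻¹ = pb-inv
    ; ∘-resp-≈ = λ (a , b) (a' , b') → S.∘-resp-≈ a a' , T.∘-resp-≈ b b'
    ; assoc = S.assoc , T.assoc
    ; identityˡ = S.identityˡ , T.identityˡ
    ; identityʳ = S.identityʳ , T.identityʳ
    ; inverseˡ = S.inverseˡ , T.inverseˡ
    ; inverseʳ = S.inverseʳ , T.inverseʳ
    }

  pb-l : Functor Pullback S
  pb-l = record { F₀ = pb-s ; F₁ = pb-φ ; F-resp-≈ = proj₁
                ; F-id = S.≈-refl ; F-∘ = S.≈-refl }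

  pb-r : Functor Pullback T
  pb-r = record { F₀ = pb-t ; F₁ = pb-ψ ; F-resp-≈ = proj₂
                ; F-id = T.≈-refl ; F-∘ = T.≈-refl }

  pb-μ : NatTrans (u ∘F pb-l) (v ∘F pb-r)
  pb-μ = record { η = λ p → tr (pb-e p) ; natural = pb-c }

_×G_ : Groupoid → Groupoid → Groupoid
A ×G B = record
  { Obj = A.Obj × B.Obj
  ; Hom = λ (a , b) (a' , b') → A.Hom a a' × B.Hom b b'
  ; _≈_ = λ (f , g) (f' , g') → (f A.≈ f') × (g B.≈ g')
  ; ≈-refl = A.≈-refl , B.≈-refl
  ; ≈-sym = λ (p , q) → A.≈-sym p , B.≈-sym q
  ; ≈-trans = λ (p , q) (p' , q') → A.≈-trans p p' , B.≈-trans q q'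
  ; id = A.id , B.id
  ; _∘_ = λ (f , g) (f' , g') → (f A.∘ f') , (g B.∘ g')
  ; _⁻¹ = λ (f , g) → (f A.⁻¹) , (g B.⁻¹)
  ; ∘-resp-≈ = λ (p , q) (p' , q') → A.∘-resp-≈ p p' , B.∘-resp-≈ q q'
  ; assoc = A.assoc , B.assoc
  ; identityˡ = A.identityˡ , B.identityˡ
  ; identityʳ = A.identityʳ , B.identityʳ
  ; inverseˡ = A.inverseˡ , B.inverseˡ
  ; inverseʳ = A.inverseʳ , B.inverseʳ
  }
  where
    module A = Groupoid A
    module B = Groupoid B

π₁ : ∀ {A B} → Functor (A ×G B) A
π₁ {A} = record { F₀ = proj₁ ; F₁ = proj₁ ; F-resp-≈ = proj₁
                ; F-id = Groupoid.≈-refl A ; F-∘ = Groupoid.≈-refl A }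

π₂ : ∀ {A B} → Functor (A ×G B) B
π₂ {B = B} = record { F₀ = proj₂ ; F₁ = proj₂ ; F-resp-≈ = proj₂
                    ; F-id = Groupoid.≈-refl B ; F-∘ = Groupoid.≈-refl B }

⟨_,_⟩F : ∀ {X A B} → Functor X A → Functor X B → Functor X (A ×G B)
⟨ F , G ⟩F = record
  { F₀ = λ x → F₀ F x , F₀ G x
  ; F₁ = λ f → F₁ F f , F₁ G f
  ; F-resp-≈ = λ p → F-resp-≈ F p , F-resp-≈ G p
  ; F-id = F-id F , F-id G
  ; F-∘ = F-∘ F , F-∘ G
  }

_×F_ : ∀ {A B C D} → Functor A C → Functor B D → Functor (A ×G B) (C ×G D)
F ×F G = record
  { F₀ = λ (a , b) → F₀ F a , F₀ G b
  ; F₁ = λ (f , g) → F₁ F f , F₁ G g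
  ; F-resp-≈ = λ (p , q) → F-resp-≈ F p , F-resp-≈ G q
  ; F-id = F-id F , F-id G
  ; F-∘ = F-∘ F , F-∘ G
  }

record Prestrategy (A : Groupoid) : Set₁ where
  constructor prestrategy
  field
    carrier : Groupoid
    ∂ : Functor carrier A

open Prestrategy public

_⊥_ : ∀ {B} → Prestrategy B → Prestrategy B → Set₁
S ⊥ T = IsBipullback (∂ S) (∂ T) (Pullback (∂ S) (∂ T))
          (pb-l (∂ S) (∂ T)) (pb-r (∂ S) (∂ T)) (pb-μ (∂ S) (∂ T))

-- 𝐒^⊥ = { T | ∀ S ∈ 𝐒, S ⊥ T }   (sets of prestrategies = predicates)
_^⊥ : ∀ {B} → (Prestrategy B → Set₁) → Prestrategy B → Set₁
(𝐒 ^⊥) T = ∀ (S : Prestrategy _) → 𝐒 S → S ⊥ T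

_⊠_ : ∀ {A B} → Prestrategy A → Prestrategy B → Prestrategy (A ×G B)
S ⊠ U = prestrategy (carrier S ×G carrier U) (∂ S ×F ∂ U)

record WideSubgroupoid (G : Groupoid) : Set₁ where
  private module G = Groupoid G
  field
    mem : ∀ {x y} → G.Hom x y → Set
    mem-resp-≈ : ∀ {x y} {f g : G.Hom x y} → f G.≈ g → mem f → mem g
    mem-id : ∀ {x} → mem (G.id {x})
    mem-∘  : ∀ {x y z} {f : G.Hom x y} {g : G.Hom y z} → mem f → mem g → mem (g G.∘ f)
    mem-⁻¹ : ∀ {x y} {f : G.Hom x y} → mem f → mem (f G.⁻¹)

open WideSubgroupoid public

record UniformGroupoid : Set₂ where
  field
    grp : Groupoid
    𝐔 : Prestrategy grp → Set₁
    biorth₁ : ∀ T → 𝐔 T → ((𝐔 ^⊥) ^⊥) T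
    biorth₂ : ∀ T → ((𝐔 ^⊥) ^⊥) T → 𝐔 T

record PolarizedUniformGroupoid : Set₂ where
  field
    uniform : UniformGroupoid
  open UniformGroupoid uniform public
  field
    neg : WideSubgroupoid grp
    pos : WideSubgroupoid grp

open PolarizedUniformGroupoid public

⊸grp : PolarizedUniformGroupoid → PolarizedUniformGroupoid → Groupoid
⊸grp A B = grp A ×G grp B

⊸𝐔 : (A B : PolarizedUniformGroupoid) → Prestrategy (⊸grp A B) → Set₁
⊸𝐔 A B T = ∀ (S : Prestrategy (grp A)) (U : Prestrategy (grp B)) →
             𝐔 A S → (𝐔 B ^⊥) U → (S ⊠ U) ⊥ T

⊸pos : (A B : PolarizedUniformGroupoid) →
       ∀ {x y} → Hom (⊸grp A B) x y → Set
⊸pos A B (f , g) = mem (neg A) f × mem (pos B) g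

⊸neg : (A B : PolarizedUniformGroupoid) →
       ∀ {x y} → Hom (⊸grp A B) x y → Set
⊸neg A B (f , g) = mem (pos A) f × mem (neg B) g

Thin : (D : Groupoid) (Pos : ∀ {x y} → Hom D x y → Set) → Prestrategy D → Set
Thin D Pos S = ∀ {s s' : Obj (carrier S)} (φ : Hom (carrier S) s s') →
               Pos (F₁ (∂ S) φ) →
               Σ[ e ∈ s ≡ s' ] Groupoid._≈_ (carrier S) (subst (Hom (carrier S) s) e (Groupoid.id (carrier S))) φ

module _ {A B C : Groupoid} (S : Prestrategy (A ×G B)) (T : Prestrategy (B ×G C)) where

  ∂S_A : Functor (carrier S) A
  ∂S_A = π₁ ∘F ∂ S
  ∂S_B : Functor (carrier S) B
  ∂S_B = π₂ ∘F ∂ S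
  ∂T_B : Functor (carrier T) B
  ∂T_B = π₁ ∘F ∂ T
  ∂T_C : Functor (carrier T) C
  ∂T_C = π₂ ∘F ∂ T

  CompPb : Groupoid
  CompPb = Pullback ∂S_B ∂T_B

  _⊙_ : Prestrategy (A ×G C)
  _⊙_ = prestrategy CompPb ⟨ ∂S_A ∘F pb-l ∂S_B ∂T_B , ∂T_C ∘F pb-r ∂S_B ∂T_B ⟩F

  record ReindexingProblem : Set where
    constructor problem
    field
      rp-s : Obj (carrier S)
      rp-t : Obj (carrier T)
      rp-θ : Hom B (F₀ ∂S_B rp-s) (F₀ ∂T_B rp-t)

  open ReindexingProblem public

  record Solution (P : ReindexingProblem) : Set where
    field
      s' : Obj (carrier S)
      t' : Obj (carrier T)
      φ  : Hom (carrier S) (rp-s P) s'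
      ψ  : Hom (carrier T) t' (rp-t P)
      mid : F₀ ∂S_B s' ≡ F₀ ∂T_B t'
      factor : Groupoid._≈_ B (rp-θ P)
                 (Groupoid._∘_ B (F₁ ∂T_B ψ)
                   (subst (Hom B (F₀ ∂S_B (rp-s P))) mid (F₁ ∂S_B φ)))

  open Solution public

  IsPositive : (Neg-A : ∀ {x y} → Hom A x y → Set) (Pos-C : ∀ {x y} → Hom C x y → Set) →
               ∀ {P} → Solution P → Set
  IsPositive Neg-A Pos-C σ = Neg-A (F₁ ∂S_A (φ σ)) × Pos-C (F₁ ∂T_C (ψ σ))

  SameSolution : ∀ {P} → Solution P → Solution P → Set
  SameSolution {P} σ σ' =
    (Σ[ e ∈ s' σ ≡ s' σ' ]
       Groupoid._≈_ (carrier S) (subst (Hom (carrier S) (rp-s P)) e (φ σ)) (φ σ'))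
    ×
    (Σ[ e ∈ t' σ ≡ t' σ' ]
       Groupoid._≈_ (carrier T) (subst (λ x → Hom (carrier T) x (rp-t P)) e (ψ σ)) (ψ σ'))

{-# OPTIONS --safe #-}
module Submission where

-- Two positive solutions (φ, ψ) and (φ', ψ') of the same problem (s, θ, t)
-- differ by the morphism (φ' φ⁻¹, ψ'⁻¹ ψ) of the composition pullback: it is
-- a morphism of pullbacks because ∂ψ ∘ ∂φ and ∂ψ' ∘ ∂φ' both equal θ, and its
-- display is positive in A ⊸ C because A₋ and C₊ are closed under composition
-- and inverses.  Thinness of T ⊙ S forces it to be an identity, whence
-- φ = φ' and ψ = ψ'.

open import Defs
open import Data.Product using (Σ-syntax; _×_; _,_)
open import Relation.Binary.PropositionalEquality using (_≡_; refl; subst; cong)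
import Relation.Binary.Reasoning.Setoid as SetoidR

module GroupoidProperties (G : Groupoid) where
  open Groupoid G

  idAlong : ∀ {x y} → x ≡ y → Hom x y
  idAlong {x} e = subst (Hom x) e id

  subst-cod≈idAlong-∘ : ∀ {x y y'} (e : y ≡ y') (f : Hom x y) →
                        subst (Hom x) e f ≈ idAlong e ∘ f
  subst-cod≈idAlong-∘ refl f = ≈-sym identityˡ

  idAlong-∘⇒subst-cod : ∀ {x y y'} (e : y ≡ y') {f : Hom x y} {f' : Hom x y'} →
                        idAlong e ∘ f ≈ f' → subst (Hom x) e f ≈ f'
  idAlong-∘⇒subst-cod refl p = ≈-trans (≈-sym identityˡ) p

  ∘-idAlong⇒subst-dom : ∀ {x y y'} (e : y ≡ y') {f : Hom y x} {f' : Hom y' x} →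
                        f' ∘ idAlong e ≈ f → subst (λ z → Hom z x) e f ≈ f'
  ∘-idAlong⇒subst-dom refl p = ≈-sym (≈-trans (≈-sym identityʳ) p)

  cancelˡ : ∀ {x y z} {g : Hom y z} {f f' : Hom x y} → g ∘ f ≈ g ∘ f' → f ≈ f'
  cancelˡ {g = g} {f} {f'} p = begin
    f                  ≈⟨ ≈-sym identityˡ ⟩
    id ∘ f             ≈⟨ ∘-resp-≈ (≈-sym inverseˡ) ≈-refl ⟩
    ((g ⁻¹) ∘ g) ∘ f   ≈⟨ assoc ⟩
    (g ⁻¹) ∘ (g ∘ f)   ≈⟨ ∘-resp-≈ ≈-refl p ⟩
    (g ⁻¹) ∘ (g ∘ f')  ≈⟨ ≈-sym assoc ⟩
    ((g ⁻¹) ∘ g) ∘ f'  ≈⟨ ∘-resp-≈ inverseˡ ≈-refl ⟩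
    id ∘ f'            ≈⟨ identityˡ ⟩
    f'                 ∎
    where open SetoidR (homSetoid _ _)

  ∘-⁻¹-cancelʳ : ∀ {x y z} {f : Hom x y} {g : Hom x z} → (g ∘ (f ⁻¹)) ∘ f ≈ g
  ∘-⁻¹-cancelʳ = ≈-trans assoc (≈-trans (∘-resp-≈ ≈-refl inverseˡ) identityʳ)

  ⁻¹-∘-cancelˡ : ∀ {x y z} {f : Hom x y} {g : Hom z y} → g ∘ ((g ⁻¹) ∘ f) ≈ f
  ⁻¹-∘-cancelˡ = ≈-trans (≈-sym assoc) (≈-trans (∘-resp-≈ inverseʳ ≈-refl) identityˡ)

  factorisations-square : ∀ {x y y' z z' w}
    {a : Hom x y} {m : Hom y z} {b : Hom z w}
    {a' : Hom x y'} {m' : Hom y' z'} {b' : Hom z' w} →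
    b ∘ (m ∘ a) ≈ b' ∘ (m' ∘ a') → m' ∘ (a' ∘ (a ⁻¹)) ≈ ((b' ⁻¹) ∘ b) ∘ m
  factorisations-square {a = a} {m} {b} {a'} {m'} {b'} p = cancelˡ (begin
    b' ∘ (m' ∘ (a' ∘ (a ⁻¹)))  ≈⟨ ∘-resp-≈ ≈-refl (≈-sym assoc) ⟩
    b' ∘ ((m' ∘ a') ∘ (a ⁻¹))  ≈⟨ ≈-sym assoc ⟩
    (b' ∘ (m' ∘ a')) ∘ (a ⁻¹)  ≈⟨ ∘-resp-≈ (≈-sym p) ≈-refl ⟩
    (b ∘ (m ∘ a)) ∘ (a ⁻¹)     ≈⟨ ∘-resp-≈ (≈-sym assoc) ≈-refl ⟩
    ((b ∘ m) ∘ a) ∘ (a ⁻¹)     ≈⟨ assoc ⟩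
    (b ∘ m) ∘ (a ∘ (a ⁻¹))     ≈⟨ ∘-resp-≈ ≈-refl inverseʳ ⟩
    (b ∘ m) ∘ id               ≈⟨ identityʳ ⟩
    b ∘ m                      ≈⟨ ≈-sym ⁻¹-∘-cancelˡ ⟩
    b' ∘ ((b' ⁻¹) ∘ (b ∘ m))   ≈⟨ ∘-resp-≈ ≈-refl (≈-sym assoc) ⟩
    b' ∘ (((b' ⁻¹) ∘ b) ∘ m)   ∎)
    where open SetoidR (homSetoid _ _)

module _ {C D : Groupoid} (F : Functor C D) where
  private
    module C = Groupoid C
    module D = Groupoid D

  F-∘-⁻¹ : ∀ {x y z} {f : C.Hom x y} {g : C.Hom x z} →
           F₁ F (g C.∘ (f C.⁻¹)) D.≈ F₁ F g D.∘ (F₁ F f D.⁻¹)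
  F-∘-⁻¹ = D.≈-trans (F-∘ F) (D.∘-resp-≈ D.≈-refl (F-inv F))

  F-⁻¹-∘ : ∀ {x y z} {f : C.Hom x y} {g : C.Hom z y} →
           F₁ F ((g C.⁻¹) C.∘ f) D.≈ (F₁ F g D.⁻¹) D.∘ F₁ F f
  F-⁻¹-∘ = D.≈-trans (F-∘ F) (D.∘-resp-≈ (F-inv F) D.≈-refl)

  mem-F-∘-⁻¹ : (W : WideSubgroupoid D) → ∀ {x y z} {f : C.Hom x y} {g : C.Hom x z} →
               mem W (F₁ F f) → mem W (F₁ F g) → mem W (F₁ F (g C.∘ (f C.⁻¹)))
  mem-F-∘-⁻¹ W f∈W g∈W = mem-resp-≈ W (D.≈-sym F-∘-⁻¹) (mem-∘ W (mem-⁻¹ W f∈W) g∈W)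

  mem-F-⁻¹-∘ : (W : WideSubgroupoid D) → ∀ {x y z} {f : C.Hom x y} {g : C.Hom z y} →
               mem W (F₁ F f) → mem W (F₁ F g) → mem W (F₁ F ((g C.⁻¹) C.∘ f))
  mem-F-⁻¹-∘ W f∈W g∈W = mem-resp-≈ W (D.≈-sym F-⁻¹-∘) (mem-∘ W f∈W (mem-⁻¹ W g∈W))

module _ {S B T : Groupoid} (u : Functor S B) (v : Functor T B) where

  pb-φ-subst : ∀ {p q q' : PbObj u v} (e : q ≡ q') (h : PbHom u v p q) →
               pb-φ (subst (PbHom u v p) e h) ≡ subst (Groupoid.Hom S (pb-s p)) (cong pb-s e) (pb-φ h)
  pb-φ-subst refl h = refl

  pb-ψ-subst : ∀ {p q q' : PbObj u v} (e : q ≡ q') (h : PbHom u v p q) →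
               pb-ψ (subst (PbHom u v p) e h) ≡ subst (Groupoid.Hom T (pb-t p)) (cong pb-t e) (pb-ψ h)
  pb-ψ-subst refl h = refl

module _ {A B C : Groupoid} (S : Prestrategy (A ×G B)) (T : Prestrategy (B ×G C)) where
  private
    module S = Groupoid (carrier S)
    module T = Groupoid (carrier T)
    module B = Groupoid B
    module PS = GroupoidProperties (carrier S)
    module PT = GroupoidProperties (carrier T)
    module PB = GroupoidProperties B
    module ST = Groupoid (CompPb S T)

  meeting : ∀ {P} → Solution S T P → PbObj (∂S_B S T) (∂T_B S T)
  meeting σ = pbObj (s' σ) (t' σ) (mid σ)

  factor-idAlong : ∀ {P} (σ : Solution S T P) →
                   rp-θ P B.≈ F₁ (∂T_B S T) (ψ σ) B.∘ (PB.idAlong (mid σ) B.∘ F₁ (∂S_B S T) (φ σ))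
  factor-idAlong σ =
    B.≈-trans (factor σ) (B.∘-resp-≈ B.≈-refl (PB.subst-cod≈idAlong-∘ (mid σ) _))

  comparison : ∀ {P} (σ σ' : Solution S T P) →
               PbHom (∂S_B S T) (∂T_B S T) (meeting σ) (meeting σ')
  comparison σ σ' = pbHom (φ σ' S.∘ (φ σ S.⁻¹)) ((ψ σ' T.⁻¹) T.∘ ψ σ) (begin
      PB.idAlong (mid σ') B.∘ F₁ (∂S_B S T) (φ σ' S.∘ (φ σ S.⁻¹))
        ≈⟨ B.∘-resp-≈ B.≈-refl (F-∘-⁻¹ (∂S_B S T)) ⟩
      PB.idAlong (mid σ') B.∘ (F₁ (∂S_B S T) (φ σ') B.∘ (F₁ (∂S_B S T) (φ σ) B.⁻¹))
        ≈⟨ PB.factorisations-square (B.≈-trans (B.≈-sym (factor-idAlong σ)) (factor-idAlong σ')) ⟩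
      ((F₁ (∂T_B S T) (ψ σ') B.⁻¹) B.∘ F₁ (∂T_B S T) (ψ σ)) B.∘ PB.idAlong (mid σ)
        ≈⟨ B.∘-resp-≈ (B.≈-sym (F-⁻¹-∘ (∂T_B S T))) B.≈-refl ⟩
      F₁ (∂T_B S T) ((ψ σ' T.⁻¹) T.∘ ψ σ) B.∘ PB.idAlong (mid σ) ∎)
    where open SetoidR (B.homSetoid _ _)

  comparison-positive : (Neg-A : WideSubgroupoid A) (Pos-C : WideSubgroupoid C) →
    ∀ {P} (σ σ' : Solution S T P) →
    IsPositive S T (mem Neg-A) (mem Pos-C) σ → IsPositive S T (mem Neg-A) (mem Pos-C) σ' →
    mem Neg-A (F₁ (∂S_A S T) (pb-φ (comparison σ σ'))) ×
    mem Pos-C (F₁ (∂T_C S T) (pb-ψ (comparison σ σ')))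
  comparison-positive Neg-A Pos-C σ σ' (φ∈A₋ , ψ∈C₊) (φ'∈A₋ , ψ'∈C₊) =
    mem-F-∘-⁻¹ (∂S_A S T) Neg-A φ∈A₋ φ'∈A₋ , mem-F-⁻¹-∘ (∂T_C S T) Pos-C ψ∈C₊ ψ'∈C₊

  comparison-identity⇒same : ∀ {P} (σ σ' : Solution S T P) →
    Σ[ e ∈ meeting σ ≡ meeting σ' ]
      subst (Groupoid.Hom (CompPb S T) (meeting σ)) e (Groupoid.id (CompPb S T)) ST.≈ comparison σ σ' →
    SameSolution S T σ σ'
  comparison-identity⇒same σ σ' (e , id≈φ , id≈ψ) =
    ( cong pb-s e
    , PS.idAlong-∘⇒subst-cod (cong pb-s e)
        (S.≈-trans (S.∘-resp-≈ idAlong≈φ S.≈-refl) PS.∘-⁻¹-cancelʳ) )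
    , ( cong pb-t e
      , PT.∘-idAlong⇒subst-dom (cong pb-t e)
          (T.≈-trans (T.∘-resp-≈ T.≈-refl idAlong≈ψ) PT.⁻¹-∘-cancelˡ) )
    where
      idAlong≈φ : PS.idAlong (cong pb-s e) S.≈ φ σ' S.∘ (φ σ S.⁻¹)
      idAlong≈φ = subst (S._≈ _) (pb-φ-subst (∂S_B S T) (∂T_B S T) e _) id≈φ
      idAlong≈ψ : PT.idAlong (cong pb-t e) T.≈ (ψ σ' T.⁻¹) T.∘ ψ σ
      idAlong≈ψ = subst (T._≈ _) (pb-ψ-subst (∂S_B S T) (∂T_B S T) e _) id≈ψ

lemma2 : (A B C : PolarizedUniformGroupoid)
         (S : Prestrategy (⊸grp A B)) (T : Prestrategy (⊸grp B C)) →
         ⊸𝐔 A B S → ⊸𝐔 B C T →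
         ⊸𝐔 A C (_⊙_ S T) →
         Thin (⊸grp A C) (⊸pos A C) (_⊙_ S T) →
         (P : ReindexingProblem S T)
         (σ σ' : Solution S T P) →
         IsPositive S T (mem (neg A)) (mem (pos C)) σ →
         IsPositive S T (mem (neg A)) (mem (pos C)) σ' →
         SameSolution S T σ σ'
lemma2 A B C S T _ _ _ thin P σ σ' σ⁺ σ'⁺ =
  comparison-identity⇒same S T σ σ'
    (thin (comparison S T σ σ') (comparison-positive S T (neg A) (pos C) σ σ' σ⁺ σ'⁺))
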